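{- For $k_1,\ldots,k_r\in\mathbb{Z}_{\ge0}$ there exists a polynomial $P(x;k_1,\ldots,k_r)\in\mathbb{Z}[x]$ such that \[\mathrm{Li}_{ -k_1,\ldots,-k_r}(z)=\frac{P(z;k_1,\ldots,k_r)}{(1-z)^{k_1+\cdots+k_r+r}},\] $\deg P(x;k_1,\ldots,k_r)=r$ if $k_1=\cdots=k_r=0$ and $=k_1+\cdots+k_r+r-1$ otherwise, and $x^r$ divides $P(x;k_1,\ldots,k_r)$. Moreover $P(x;0,\ldots,0)=x^r$.
   Context: $\mathrm{Li}_{k_1,\ldots,k_r}(z)=\sum_{1\le m_1<\cdots<m_r} \frac{z^{m_r}}{m_1^{k_1}\cdots m_r^{k_r}}$ for integers $k_i$ and $|z|<1$. -}

module Defs where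

open import Data.Nat using (ℕ; zero; suc; _+_; _*_; _^_; _<_)
open import Data.Integer using (ℤ; +_; _-_; 0ℤ; 1ℤ)
open import Data.List using (List; []; _∷_; foldl; replicate; _++_)
open import Data.Product using (Σ; _×_)
open import Relation.Binary.PropositionalEquality using (_≡_)
open import Relation.Nullary using (¬_)

Series : Set
Series = ℕ → ℤ

sumBelow : (ℕ → ℕ) → ℕ → ℕ
sumBelow f zero    = 0
sumBelow f (suc n) = sumBelow f n + f n

-- g n = weighted count of chains 0 = m_0 < m_1 < ... < m_j = n processed so far.
liStart : ℕ → ℕ
liStart zero    = 1
liStart (suc n) = 0

-- append one more index m_{j+1} = n with weight n^k
liStep : (ℕ → ℕ) → ℕ → (ℕ → ℕ)
liStep g k n = (n ^ k) * sumBelow g n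

-- Coefficient of z^n in Li_{-k_1,...,-k_r}(z):
--   Σ_{1 ≤ m_1 < ... < m_r = n} m_1^{k_1} ⋯ m_r^{k_r}
liNegCoeff : List ℕ → ℕ → ℕ
liNegCoeff ks = foldl liStep liStart ks

LiNeg : List ℕ → Series
LiNeg ks n = + liNegCoeff ks n

mulOneMinusZ : Series → Series
mulOneMinusZ f zero    = f zero
mulOneMinusZ f (suc n) = f (suc n) - f n

mulOneMinusZPow : ℕ → Series → Series
mulOneMinusZPow zero    f = f
mulOneMinusZPow (suc N) f = mulOneMinusZ (mulOneMinusZPow N f)

-- Polynomials in ℤ[x] as coefficient lists (constant term first).
Poly : Set
Poly = List ℤ

coeff : Poly → ℕ → ℤ
coeff []      n       = 0ℤ
coeff (a ∷ p) zero    = a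
coeff (a ∷ p) (suc n) = coeff p n

HasDegree : Poly → ℕ → Set
HasDegree p d = (¬ (coeff p d ≡ 0ℤ)) × (∀ n → d < n → coeff p n ≡ 0ℤ)

mulXPow : ℕ → Poly → Poly
mulXPow r q = replicate r 0ℤ ++ q

xPow : ℕ → Poly
xPow r = mulXPow r (1ℤ ∷ [])

XPowDivides : ℕ → Poly → Set
XPowDivides r p = Σ Poly (λ q → ∀ n → coeff p n ≡ coeff (mulXPow r q) n)

{-# OPTIONS --safe #-}
module Submission where

-- Write g = p/(1-z)^M with p a polynomial of degree ≤ M with natural-number
-- coefficients.  Li_{-k_1,...,-k_r} arises from 1 by alternately taking partial sums,
-- which turn p/(1-z)^M into z p/(1-z)^{M+1}, and applying z d/dz k_i times, which
-- turns it into ((1-z) z p' + M z p)/(1-z)^{M+1}; the new numerator has coefficients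
-- (n+1) p_{n+1} + (M-n) p_n, again natural numbers of degree ≤ M+1.  The r partial
-- sums contribute the factor x^r, and while all k_i vanish P = x^r.  The first z d/dz
-- applied to a numerator of degree exactly M ≥ 1 keeps the degree M while the exponent
-- becomes M+1; afterwards both grow in step, so deg P = k_1+...+k_r+r-1.

open import Defs
open import Data.Nat.Base using (ℕ; zero; suc; _+_; _*_; _^_; _∸_; _<_; _≤_; z≤n; s≤s)
open import Data.Nat.Properties
  using (+-suc; +-identityʳ; *-assoc; *-zeroʳ; *-identityˡ; ≤-trans; n≤1+n; m≤n+m; m≤m+n;
         m+n∸m≡n; m+n∸n≡m; m≤n⇒m∸n≡0; n>0⇒n≢0; ≰⇒>; _≤?_)
import Data.Nat.Tactic.RingSolver as ℕ-Solver
open import Data.Nat.ListAction using (sum)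
open import Data.Integer.Base as ℤ using (ℤ; +_; 0ℤ; 1ℤ)
import Data.Integer.Properties as ℤ
open import Data.Integer.Tactic.RingSolver using (solve-∀)
open import Data.List.Base using (List; []; _∷_; length; foldl; drop)
open import Data.List.Properties using (drop-[])
open import Data.List.Relation.Unary.All using (All; []; _∷_)
open import Data.Product.Base using (Σ; _×_; _,_)
open import Data.Sum.Base using (_⊎_; inj₁; inj₂)
open import Data.Empty using (⊥-elim)
open import Relation.Binary.PropositionalEquality
  using (_≡_; _≢_; _≗_; refl; sym; trans; cong; cong₂; subst; module ≡-Reasoning)
open import Relation.Nullary using (¬_; yes; no)

open ≡-Reasoning

zMul : Series → Series
zMul f zero    = 0ℤ
zMul f (suc n) = f n

zDeriv : Series → Series
zDeriv f n = + n ℤ.* f n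

-- (1-z)^{M+1} · z (h/(1-z)^M)' = (1-z) z h' + M z h
derivNumerator : ℕ → Series → Series
derivNumerator M h n = mulOneMinusZ (zDeriv h) n ℤ.+ + M ℤ.* zMul h n

toSeries : (ℕ → ℕ) → Series
toSeries g n = + g n

mulOneMinusZ-cong : ∀ {f g} → f ≗ g → mulOneMinusZ f ≗ mulOneMinusZ g
mulOneMinusZ-cong f≗g zero    = f≗g zero
mulOneMinusZ-cong f≗g (suc n) = cong₂ ℤ._-_ (f≗g (suc n)) (f≗g n)

mulOneMinusZPow-cong : ∀ N {f g} → f ≗ g → mulOneMinusZPow N f ≗ mulOneMinusZPow N g
mulOneMinusZPow-cong zero    f≗g = f≗g
mulOneMinusZPow-cong (suc N) f≗g = mulOneMinusZ-cong (mulOneMinusZPow-cong N f≗g)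

zMul-cong : ∀ {f g} → f ≗ g → zMul f ≗ zMul g
zMul-cong f≗g zero    = refl
zMul-cong f≗g (suc n) = f≗g n

mulOneMinusZ-zMul : ∀ f → mulOneMinusZ (zMul f) ≗ zMul (mulOneMinusZ f)
mulOneMinusZ-zMul f zero          = refl
mulOneMinusZ-zMul f (suc zero)    = ℤ.+-identityʳ (f 0)
mulOneMinusZ-zMul f (suc (suc n)) = refl

mulOneMinusZPow-mulOneMinusZ : ∀ N f →
  mulOneMinusZPow N (mulOneMinusZ f) ≗ mulOneMinusZ (mulOneMinusZPow N f)
mulOneMinusZPow-mulOneMinusZ zero    f n = refl
mulOneMinusZPow-mulOneMinusZ (suc N) f   = mulOneMinusZ-cong (mulOneMinusZPow-mulOneMinusZ N f)

mulOneMinusZPow-zMul : ∀ N f → mulOneMinusZPow N (zMul f) ≗ zMul (mulOneMinusZPow N f)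
mulOneMinusZPow-zMul zero    f n = refl
mulOneMinusZPow-zMul (suc N) f n =
  trans (mulOneMinusZ-cong (mulOneMinusZPow-zMul N f) n) (mulOneMinusZ-zMul (mulOneMinusZPow N f) n)

-- Since z((1-z)a)' = (1-z) z a' - z a, both sides equal (1-z)² z a' + M z (1-z) a.
derivNumerator-mulOneMinusZ : ∀ M a →
  derivNumerator (suc M) (mulOneMinusZ a) ≗ mulOneMinusZ (derivNumerator M a)
derivNumerator-mulOneMinusZ M a zero =
  identity₀ (a 0) (+ M)
  where
  identity₀ : ∀ a₀ m → + 0 ℤ.* a₀ ℤ.+ (1ℤ ℤ.+ m) ℤ.* 0ℤ ≡ + 0 ℤ.* a₀ ℤ.+ m ℤ.* 0ℤ
  identity₀ = solve-∀
derivNumerator-mulOneMinusZ M a (suc zero) =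
  identity₁ (a 0) (a 1) (+ M)
  where
  identity₁ : ∀ a₀ a₁ m →
    (+ 1 ℤ.* (a₁ ℤ.- a₀) ℤ.- + 0 ℤ.* a₀) ℤ.+ (1ℤ ℤ.+ m) ℤ.* a₀
      ≡ ((+ 1 ℤ.* a₁ ℤ.- + 0 ℤ.* a₀) ℤ.+ m ℤ.* a₀) ℤ.- (+ 0 ℤ.* a₀ ℤ.+ m ℤ.* 0ℤ)
  identity₁ = solve-∀
derivNumerator-mulOneMinusZ M a (suc (suc n)) =
  identity₂ (+ n) (+ M) (a n) (a (suc n)) (a (suc (suc n)))
  where
  identity₂ : ∀ x m a₀ a₁ a₂ →
    ((1ℤ ℤ.+ (1ℤ ℤ.+ x)) ℤ.* (a₂ ℤ.- a₁) ℤ.- (1ℤ ℤ.+ x) ℤ.* (a₁ ℤ.- a₀)) ℤ.+ (1ℤ ℤ.+ m) ℤ.* (a₁ ℤ.- a₀)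
      ≡ (((1ℤ ℤ.+ (1ℤ ℤ.+ x)) ℤ.* a₂ ℤ.- (1ℤ ℤ.+ x) ℤ.* a₁) ℤ.+ m ℤ.* a₁)
        ℤ.- (((1ℤ ℤ.+ x) ℤ.* a₁ ℤ.- x ℤ.* a₀) ℤ.+ m ℤ.* a₀)
  identity₂ = solve-∀

mulOneMinusZPow-zDeriv : ∀ M f →
  mulOneMinusZPow (suc M) (zDeriv f) ≗ derivNumerator M (mulOneMinusZPow M f)
mulOneMinusZPow-zDeriv zero f n =
  sym (trans (cong (λ t → mulOneMinusZ (zDeriv f) n ℤ.+ t) (ℤ.*-zeroˡ (zMul f n))) (ℤ.+-identityʳ _))
mulOneMinusZPow-zDeriv (suc M) f n = begin
  mulOneMinusZ (mulOneMinusZPow (suc M) (zDeriv f)) n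
    ≡⟨ mulOneMinusZ-cong (mulOneMinusZPow-zDeriv M f) n ⟩
  mulOneMinusZ (derivNumerator M (mulOneMinusZPow M f)) n
    ≡⟨ derivNumerator-mulOneMinusZ M (mulOneMinusZPow M f) n ⟨
  derivNumerator (suc M) (mulOneMinusZPow (suc M) f) n ∎

VanishesAbove : ℕ → (ℕ → ℕ) → Set
VanishesAbove d p = ∀ n → d < n → p n ≡ 0

VanishesBelow : ℕ → (ℕ → ℕ) → Set
VanishesBelow j p = ∀ n → n < j → p n ≡ 0

xMul : (ℕ → ℕ) → ℕ → ℕ
xMul p zero    = 0
xMul p (suc n) = p n

xMulPow : ℕ → (ℕ → ℕ) → ℕ → ℕ
xMulPow zero    p = p
xMulPow (suc r) p = xMul (xMulPow r p)

-- The coefficients of derivNumerator M p; they are natural numbers as long as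
-- deg p ≤ M, which is exactly when the truncated subtraction M ∸ n is harmless.
eulerStep : ℕ → (ℕ → ℕ) → ℕ → ℕ
eulerStep M p zero    = 0
eulerStep M p (suc n) = suc n * p (suc n) + (M ∸ n) * p n

eulerSteps : ℕ → ℕ → (ℕ → ℕ) → ℕ → ℕ
eulerSteps zero    M p = p
eulerSteps (suc k) M p = eulerStep (k + M) (eulerSteps k M p)

denomExp : List ℕ → ℕ → ℕ
denomExp []       M = M
denomExp (k ∷ ks) M = denomExp ks (k + suc M)

liNumerator : List ℕ → ℕ → (ℕ → ℕ) → ℕ → ℕ
liNumerator []       M p = p
liNumerator (k ∷ ks) M p = liNumerator ks (k + suc M) (eulerSteps k (suc M) (xMul p))

denomExp-closed : ∀ ks M → denomExp ks M ≡ M + (sum ks + length ks)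
denomExp-closed []       M = sym (+-identityʳ M)
denomExp-closed (k ∷ ks) M = trans (denomExp-closed ks (k + suc M)) (regroup k M (sum ks) (length ks))
  where
  regroup : ∀ k M s l → k + suc M + (s + l) ≡ M + (k + s + suc l)
  regroup = ℕ-Solver.solve-∀

xMul-vanishesAbove : ∀ {d p} → VanishesAbove d p → VanishesAbove (suc d) (xMul p)
xMul-vanishesAbove p≡0 (suc n) (s≤s d<n) = p≡0 n d<n

eulerStep-vanishesAbove : ∀ {d p} M → VanishesAbove d p → VanishesAbove (suc d) (eulerStep M p)
eulerStep-vanishesAbove M p≡0 (suc n) (s≤s d<n)
  rewrite p≡0 (suc n) (≤-trans d<n (n≤1+n n)) | p≡0 n d<n =
    cong₂ _+_ (*-zeroʳ (suc n)) (*-zeroʳ (M ∸ n))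

eulerSteps-vanishesAbove : ∀ k {M p} → VanishesAbove M p → VanishesAbove (k + M) (eulerSteps k M p)
eulerSteps-vanishesAbove zero    p≡0 = p≡0
eulerSteps-vanishesAbove (suc k) p≡0 = eulerStep-vanishesAbove _ (eulerSteps-vanishesAbove k p≡0)

xMul-vanishesBelow : ∀ {j p} → VanishesBelow j p → VanishesBelow (suc j) (xMul p)
xMul-vanishesBelow p≡0 zero    _         = refl
xMul-vanishesBelow p≡0 (suc n) (s≤s n<j) = p≡0 n n<j

eulerStep-vanishesBelow : ∀ {j p} M → VanishesBelow j p → VanishesBelow j (eulerStep M p)
eulerStep-vanishesBelow M p≡0 zero    _ = refl
eulerStep-vanishesBelow M p≡0 (suc n) n<j
  rewrite p≡0 (suc n) n<j | p≡0 n (≤-trans (n≤1+n (suc n)) n<j) =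
    cong₂ _+_ (*-zeroʳ (suc n)) (*-zeroʳ (M ∸ n))

eulerSteps-vanishesBelow : ∀ {j} k M {p} → VanishesBelow j p → VanishesBelow j (eulerSteps k M p)
eulerSteps-vanishesBelow zero    M p≡0 = p≡0
eulerSteps-vanishesBelow (suc k) M p≡0 = eulerStep-vanishesBelow _ (eulerSteps-vanishesBelow k M p≡0)

liNumerator-vanishesBelow : ∀ ks M {j p} → VanishesBelow j p →
  VanishesBelow (length ks + j) (liNumerator ks M p)
liNumerator-vanishesBelow []       M p≡0 = p≡0
liNumerator-vanishesBelow (k ∷ ks) M {j} {p} p≡0 =
  subst (λ i → VanishesBelow i (liNumerator (k ∷ ks) M p)) (+-suc (length ks) j)
    (liNumerator-vanishesBelow ks _ (eulerSteps-vanishesBelow k (suc M) (xMul-vanishesBelow p≡0)))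

xMulPow-xMul : ∀ r p → xMulPow r (xMul p) ≗ xMul (xMulPow r p)
xMulPow-xMul zero    p n       = refl
xMulPow-xMul (suc r) p zero    = refl
xMulPow-xMul (suc r) p (suc n) = xMulPow-xMul r p n

liNumerator-allZero : ∀ ks → All (_≡ 0) ks → ∀ M p → liNumerator ks M p ≗ xMulPow (length ks) p
liNumerator-allZero []            []           M p n = refl
liNumerator-allZero (.0 ∷ ks) (refl ∷ ks≡0) M p n =
  trans (liNumerator-allZero ks ks≡0 (suc M) (xMul p) n) (xMulPow-xMul (length ks) p n)

ExactDegree : (ℕ → ℕ) → ℕ → Set
ExactDegree p d = 0 < p d × VanishesAbove d p

PredDegree : ℕ → (ℕ → ℕ) → Set
PredDegree M p = Σ ℕ λ d → M ≡ suc d × ExactDegree p d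

xMul-exactDegree : ∀ {p d} → ExactDegree p d → ExactDegree (xMul p) (suc d)
xMul-exactDegree (pd>0 , p≡0) = pd>0 , xMul-vanishesAbove p≡0

xMulPow-exactDegree : ∀ r {p d} → ExactDegree p d → ExactDegree (xMulPow r p) (r + d)
xMulPow-exactDegree zero    deg = deg
xMulPow-exactDegree (suc r) deg = xMul-exactDegree (xMulPow-exactDegree r deg)

xMul-predDegree : ∀ {M p} → PredDegree M p → PredDegree (suc M) (xMul p)
xMul-predDegree (d , refl , deg) = suc d , refl , xMul-exactDegree deg

-- deg p = M - 1: the top coefficient is (M ∸ (M-1)) · p_{M-1} = p_{M-1}.
eulerStep-predDegree : ∀ {M p} → PredDegree M p → PredDegree (suc M) (eulerStep M p)
eulerStep-predDegree {p = p} (d , refl , pd>0 , p≡0) =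
  suc d , refl , leading>0 , eulerStep-vanishesAbove (suc d) p≡0
  where
  leading>0 : 0 < suc d * p (suc d) + (suc d ∸ d) * p d
  leading>0 rewrite m+n∸n≡m 1 d | *-identityˡ (p d) = ≤-trans pd>0 (m≤n+m (p d) _)

-- deg p = M ≥ 1: the top coefficient M · p_M survives and M - (M+1) truncates to 0.
eulerStep-exactDegree : ∀ {d p} → ExactDegree p (suc d) → PredDegree (suc (suc d)) (eulerStep (suc d) p)
eulerStep-exactDegree {d} {p} (pM>0 , p≡0) = suc d , refl , leading>0 , vanishes
  where
  leading>0 : 0 < suc d * p (suc d) + (suc d ∸ d) * p d
  leading>0 = ≤-trans pM>0 (≤-trans (m≤m+n _ _) (m≤m+n _ _))
  vanishes : VanishesAbove (suc d) (eulerStep (suc d) p)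
  vanishes (suc n) (s≤s d<n) rewrite p≡0 (suc n) (s≤s d<n) | m≤n⇒m∸n≡0 d<n =
    cong₂ _+_ (*-zeroʳ (suc n)) refl

eulerSteps-predDegree : ∀ k {M p} → PredDegree M p → PredDegree (k + M) (eulerSteps k M p)
eulerSteps-predDegree zero    deg = deg
eulerSteps-predDegree (suc k) deg = eulerStep-predDegree (eulerSteps-predDegree k deg)

eulerSteps-exactDegree : ∀ k {d p} → ExactDegree p (suc d) →
  PredDegree (suc k + suc d) (eulerSteps (suc k) (suc d) p)
eulerSteps-exactDegree zero    deg = eulerStep-exactDegree deg
eulerSteps-exactDegree (suc k) deg = eulerStep-predDegree (eulerSteps-exactDegree k deg)

liNumerator-predDegree : ∀ ks {M p} → PredDegree M p → PredDegree (denomExp ks M) (liNumerator ks M p)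
liNumerator-predDegree []       deg = deg
liNumerator-predDegree (k ∷ ks) deg =
  liNumerator-predDegree ks (eulerSteps-predDegree k (xMul-predDegree deg))

liNumerator-exactDegree : ∀ ks {M p} → ExactDegree p M → ¬ All (_≡ 0) ks →
  PredDegree (denomExp ks M) (liNumerator ks M p)
liNumerator-exactDegree []           deg ks≢0 = ⊥-elim (ks≢0 [])
liNumerator-exactDegree (zero ∷ ks)  deg ks≢0 =
  liNumerator-exactDegree ks (xMul-exactDegree deg) (λ ks≡0 → ks≢0 (refl ∷ ks≡0))
liNumerator-exactDegree (suc k ∷ ks) deg ks≢0 =
  liNumerator-predDegree ks (eulerSteps-exactDegree k (xMul-exactDegree deg))

record IsNumerator (M : ℕ) (g p : ℕ → ℕ) : Set where
  field
    series  : mulOneMinusZPow M (toSeries g) ≗ toSeries p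
    bounded : VanishesAbove M p

open IsNumerator

IsNumerator-cong : ∀ {M g h p} → g ≗ h → IsNumerator M g p → IsNumerator M h p
IsNumerator-cong {M} g≗h num = record
  { series  = λ n → trans (mulOneMinusZPow-cong M (λ i → sym (cong +_ (g≗h i))) n) (series num n)
  ; bounded = bounded num
  }

mulOneMinusZ-sumBelow : ∀ g → mulOneMinusZ (toSeries (sumBelow g)) ≗ zMul (toSeries g)
mulOneMinusZ-sumBelow g zero    = refl
mulOneMinusZ-sumBelow g (suc n) = begin
  + (s + g n) ℤ.- + s   ≡⟨ ℤ.m-n≡m⊖n (s + g n) s ⟩
  (s + g n) ℤ.⊖ s       ≡⟨ ℤ.⊖-≥ (m≤m+n s (g n)) ⟩
  + (s + g n ∸ s)       ≡⟨ cong +_ (m+n∸m≡n s (g n)) ⟩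
  + g n                 ∎
  where s = sumBelow g n

zMul-toSeries : ∀ p → zMul (toSeries p) ≗ toSeries (xMul p)
zMul-toSeries p zero    = refl
zMul-toSeries p (suc n) = refl

sumBelow-numerator : ∀ {M g p} → IsNumerator M g p → IsNumerator (suc M) (sumBelow g) (xMul p)
sumBelow-numerator {M} {g} {p} num =
  record { series = series′ ; bounded = xMul-vanishesAbove (bounded num) }
  where
  series′ : mulOneMinusZPow (suc M) (toSeries (sumBelow g)) ≗ toSeries (xMul p)
  series′ n = begin
    mulOneMinusZ (mulOneMinusZPow M (toSeries (sumBelow g))) n
      ≡⟨ mulOneMinusZPow-mulOneMinusZ M (toSeries (sumBelow g)) n ⟨
    mulOneMinusZPow M (mulOneMinusZ (toSeries (sumBelow g))) n
      ≡⟨ mulOneMinusZPow-cong M (mulOneMinusZ-sumBelow g) n ⟩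
    mulOneMinusZPow M (zMul (toSeries g)) n
      ≡⟨ mulOneMinusZPow-zMul M (toSeries g) n ⟩
    zMul (mulOneMinusZPow M (toSeries g)) n
      ≡⟨ zMul-cong (series num) n ⟩
    zMul (toSeries p) n
      ≡⟨ zMul-toSeries p n ⟩
    toSeries (xMul p) n ∎

truncated-sub-* : ∀ M m x → m ≤ M ⊎ x ≡ 0 → + ((M ∸ m) * x) ≡ (+ M ℤ.- + m) ℤ.* + x
truncated-sub-* M m x (inj₁ m≤M) = begin
  + ((M ∸ m) * x)         ≡⟨ ℤ.pos-* (M ∸ m) x ⟩
  + (M ∸ m) ℤ.* + x       ≡⟨ cong (ℤ._* + x) (trans (ℤ.m-n≡m⊖n M m) (ℤ.⊖-≥ m≤M)) ⟨
  (+ M ℤ.- + m) ℤ.* + x   ∎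
truncated-sub-* M m x (inj₂ refl) =
  trans (cong +_ (*-zeroʳ (M ∸ m))) (sym (ℤ.*-zeroʳ (+ M ℤ.- + m)))

derivNumerator-toSeries : ∀ {M p} → VanishesAbove M p →
  derivNumerator M (toSeries p) ≗ toSeries (eulerStep M p)
derivNumerator-toSeries {M} {p} p≡0 zero = identity (+ p 0) (+ M)
  where
  identity : ∀ a m → + 0 ℤ.* a ℤ.+ m ℤ.* 0ℤ ≡ 0ℤ
  identity = solve-∀
derivNumerator-toSeries {M} {p} p≡0 (suc m) = sym (begin
  + (suc m * p (suc m) + (M ∸ m) * p m)
    ≡⟨ ℤ.pos-+ (suc m * p (suc m)) ((M ∸ m) * p m) ⟩
  + (suc m * p (suc m)) ℤ.+ + ((M ∸ m) * p m)
    ≡⟨ cong₂ ℤ._+_ (ℤ.pos-* (suc m) (p (suc m))) (truncated-sub-* M m (p m) harmless) ⟩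
  + suc m ℤ.* + p (suc m) ℤ.+ (+ M ℤ.- + m) ℤ.* + p m
    ≡⟨ identity (+ suc m ℤ.* + p (suc m)) (+ m) (+ p m) (+ M) ⟩
  (+ suc m ℤ.* + p (suc m) ℤ.- + m ℤ.* + p m) ℤ.+ + M ℤ.* + p m ∎)
  where
  harmless : m ≤ M ⊎ p m ≡ 0
  harmless with m ≤? M
  ... | yes m≤M = inj₁ m≤M
  ... | no  m≰M = inj₂ (p≡0 m (≰⇒> m≰M))
  identity : ∀ a x c M → a ℤ.+ (M ℤ.- x) ℤ.* c ≡ (a ℤ.- x ℤ.* c) ℤ.+ M ℤ.* c
  identity = solve-∀

zDeriv-toSeries : ∀ h → zDeriv (toSeries h) ≗ toSeries (λ n → n * h n)
zDeriv-toSeries h n = sym (ℤ.pos-* n (h n))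

zDeriv-numerator : ∀ {M h p} → IsNumerator M h p →
  IsNumerator (suc M) (λ n → n * h n) (eulerStep M p)
zDeriv-numerator {M} {h} {p} num =
  record { series = series′ ; bounded = eulerStep-vanishesAbove M (bounded num) }
  where
  series′ : mulOneMinusZPow (suc M) (toSeries (λ n → n * h n)) ≗ toSeries (eulerStep M p)
  series′ n = begin
    mulOneMinusZPow (suc M) (toSeries (λ n → n * h n)) n
      ≡⟨ mulOneMinusZPow-cong (suc M) (zDeriv-toSeries h) n ⟨
    mulOneMinusZPow (suc M) (zDeriv (toSeries h)) n
      ≡⟨ mulOneMinusZPow-zDeriv M (toSeries h) n ⟩
    derivNumerator M (mulOneMinusZPow M (toSeries h)) n
      ≡⟨ cong₂ ℤ._+_ (mulOneMinusZ-cong (λ i → cong (+ i ℤ.*_) (series num i)) n)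
                     (cong (+ M ℤ.*_) (zMul-cong (series num) n)) ⟩
    derivNumerator M (toSeries p) n
      ≡⟨ derivNumerator-toSeries (bounded num) n ⟩
    toSeries (eulerStep M p) n ∎

powMul-numerator : ∀ k {M h p} → IsNumerator M h p →
  IsNumerator (k + M) (λ n → n ^ k * h n) (eulerSteps k M p)
powMul-numerator zero    {h = h} num = IsNumerator-cong (λ n → sym (*-identityˡ (h n))) num
powMul-numerator (suc k) {h = h} num =
  IsNumerator-cong (λ n → sym (*-assoc n (n ^ k) (h n))) (zDeriv-numerator (powMul-numerator k num))

liNegCoeff-numerator : ∀ ks {M g p} → IsNumerator M g p →
  IsNumerator (denomExp ks M) (foldl liStep g ks) (liNumerator ks M p)
liNegCoeff-numerator []       num = num
liNegCoeff-numerator (k ∷ ks) num = liNegCoeff-numerator ks (powMul-numerator k (sumBelow-numerator num))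

toPoly : ℕ → (ℕ → ℕ) → Poly
toPoly zero    p = + p 0 ∷ []
toPoly (suc d) p = + p 0 ∷ toPoly d (λ n → p (suc n))

coeff-toPoly : ∀ d p → VanishesAbove d p → coeff (toPoly d p) ≗ toSeries p
coeff-toPoly zero    p p≡0 zero    = refl
coeff-toPoly zero    p p≡0 (suc n) = sym (cong +_ (p≡0 (suc n) (s≤s z≤n)))
coeff-toPoly (suc d) p p≡0 zero    = refl
coeff-toPoly (suc d) p p≡0 (suc n) =
  coeff-toPoly d (λ n → p (suc n)) (λ n d<n → p≡0 (suc n) (s≤s d<n)) n

coeff-one : coeff (1ℤ ∷ []) ≗ toSeries liStart
coeff-one zero    = refl
coeff-one (suc n) = refl

coeff-mulXPow : ∀ r {q p} → coeff q ≗ toSeries p → coeff (mulXPow r q) ≗ toSeries (xMulPow r p)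
coeff-mulXPow zero    q≗p n       = q≗p n
coeff-mulXPow (suc r) q≗p zero    = refl
coeff-mulXPow (suc r) q≗p (suc n) = coeff-mulXPow r q≗p n

mulXPow-drop : ∀ r P → (∀ n → n < r → coeff P n ≡ 0ℤ) → coeff P ≗ coeff (mulXPow r (drop r P))
mulXPow-drop zero    P       P≡0 n       = refl
mulXPow-drop (suc r) P       P≡0 zero    = P≡0 0 (s≤s z≤n)
mulXPow-drop (suc r) []      P≡0 (suc n) =
  trans (mulXPow-drop r [] (λ _ _ → refl) n) (cong (λ Q → coeff (mulXPow r Q) n) (drop-[] r))
mulXPow-drop (suc r) (a ∷ P) P≡0 (suc n) = mulXPow-drop r P (λ m m<r → P≡0 (suc m) (s≤s m<r)) n

exactDegree⇒HasDegree : ∀ P {p d} → coeff P ≗ toSeries p → ExactDegree p d → HasDegree P d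
exactDegree⇒HasDegree P {d = d} P≗p (pd>0 , p≡0) =
  (λ Pd≡0 → n>0⇒n≢0 pd>0 (ℤ.+-injective (trans (sym (P≗p d)) Pd≡0))) ,
  (λ n d<n → trans (P≗p n) (cong +_ (p≡0 n d<n)))

liStart-numerator : IsNumerator 0 liStart liStart
liStart-numerator = record { series = λ n → refl ; bounded = λ { (suc n) _ → refl } }

liStart-degree : ExactDegree liStart 0
liStart-degree = s≤s z≤n , bounded liStart-numerator

liNeg-numerator : ∀ ks → IsNumerator (sum ks + length ks) (liNegCoeff ks) (liNumerator ks 0 liStart)
liNeg-numerator ks = subst (λ M → IsNumerator M (liNegCoeff ks) (liNumerator ks 0 liStart))
  (denomExp-closed ks 0) (liNegCoeff-numerator ks liStart-numerator)

liNeg-exactDegree : ∀ ks → ¬ All (_≡ 0) ks →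
  ExactDegree (liNumerator ks 0 liStart) (sum ks + length ks ∸ 1)
liNeg-exactDegree ks ks≢0 with liNumerator-exactDegree ks liStart-degree ks≢0
... | d , E≡1+d , deg =
  subst (ExactDegree (liNumerator ks 0 liStart))
    (cong (_∸ 1) (trans (sym E≡1+d) (denomExp-closed ks 0))) deg

lemma4p1 : (ks : List ℕ) → ks ≢ [] →
    Σ Poly (λ P →
      (∀ n → mulOneMinusZPow (sum ks + length ks) (LiNeg ks) n ≡ coeff P n)
      × (All (_≡ 0) ks → HasDegree P (length ks))
      × (¬ All (_≡ 0) ks → HasDegree P (sum ks + length ks ∸ 1))
      × XPowDivides (length ks) P
      × (All (_≡ 0) ks → ∀ n → coeff P n ≡ coeff (xPow (length ks)) n))
lemma4p1 ks _ =
  P , numerator , allZero⇒degree , notAllZero⇒degree , (drop r P , mulXPow-drop r P lowZero) , allZero⇒xPow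
  where
  r = length ks
  p = liNumerator ks 0 liStart

  P : Poly
  P = toPoly (sum ks + r) p

  P≗p : coeff P ≗ toSeries p
  P≗p = coeff-toPoly (sum ks + r) p (bounded (liNeg-numerator ks))

  numerator : ∀ n → mulOneMinusZPow (sum ks + r) (LiNeg ks) n ≡ coeff P n
  numerator n = trans (series (liNeg-numerator ks) n) (sym (P≗p n))

  allZero⇒P≗xʳ : All (_≡ 0) ks → coeff P ≗ toSeries (xMulPow r liStart)
  allZero⇒P≗xʳ ks≡0 n = trans (P≗p n) (cong +_ (liNumerator-allZero ks ks≡0 0 liStart n))

  allZero⇒degree : All (_≡ 0) ks → HasDegree P r
  allZero⇒degree ks≡0 = subst (HasDegree P) (+-identityʳ r)
    (exactDegree⇒HasDegree P (allZero⇒P≗xʳ ks≡0) (xMulPow-exactDegree r liStart-degree))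

  notAllZero⇒degree : ¬ All (_≡ 0) ks → HasDegree P (sum ks + r ∸ 1)
  notAllZero⇒degree ks≢0 = exactDegree⇒HasDegree P P≗p (liNeg-exactDegree ks ks≢0)

  lowZero : ∀ n → n < r → coeff P n ≡ 0ℤ
  lowZero n n<r = trans (P≗p n)
    (cong +_ (liNumerator-vanishesBelow ks 0 (λ _ ()) n (subst (n <_) (sym (+-identityʳ r)) n<r)))

  allZero⇒xPow : All (_≡ 0) ks → ∀ n → coeff P n ≡ coeff (xPow r) n
  allZero⇒xPow ks≡0 n = trans (allZero⇒P≗xʳ ks≡0 n) (sym (coeff-mulXPow r coeff-one n))
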